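{- Let $G$ be a finite simple graph whose line graph $L(G)$ has no vertices of degree $0$ or $1$. Then there exists a bijection $f:E(G)\to E(G)$ such that for every $e\in E(G)$ the edges $e$ and $f(e)$ have exactly one vertex in common.
   Context: The line graph $L(G)$ has vertex set $E(G)$, two edges being adjacent if they share exactly one vertex. -}

module Defs where

open import Data.Nat using (ℕ)
open import Data.Fin using (Fin)
open import Data.Product using (Σ; _×_; _,_; ∃; ∃-syntax)
open import Data.Sum using (_⊎_)
open import Relation.Binary.PropositionalEquality using (_≡_)
open import Relation.Nullary using (¬_)

record SimpleGraph : Set where
  field
    n m    : ℕ
    end₁   : Fin m → Fin n
    end₂   : Fin m → Fin n
    loopless : ∀ e → ¬ end₁ e ≡ end₂ e
    noMulti  : ∀ e e′ →
      ((end₁ e ≡ end₁ e′ × end₂ e ≡ end₂ e′) ⊎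
       (end₁ e ≡ end₂ e′ × end₂ e ≡ end₁ e′)) → e ≡ e′

  Vertex : Set
  Vertex = Fin n

  Edge : Set
  Edge = Fin m

  _∈ₑ_ : Vertex → Edge → Set
  x ∈ₑ e = (x ≡ end₁ e) ⊎ (x ≡ end₂ e)

  ShareExactlyOne : Edge → Edge → Set
  ShareExactlyOne e e′ =
    Σ Vertex λ x → (x ∈ₑ e × x ∈ₑ e′) ×
      (∀ y → y ∈ₑ e → y ∈ₑ e′ → y ≡ x)

  LAdj : Edge → Edge → Set
  LAdj = ShareExactlyOne

  LDegree≥2 : Edge → Set
  LDegree≥2 e = Σ Edge λ a → Σ Edge λ b →
    ¬ a ≡ b × LAdj e a × LAdj e b

{-# OPTIONS --safe #-}
-- A bijection f with f(e) adjacent to e in L(G) is a perfect matching of the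
-- relation "shares exactly one vertex" on E(G) × E(G); an injective self-map of a finite
-- set is bijective, so by Hall's theorem it suffices that |S| ≤ |N(S)| for every set S of
-- edges.  The edges I = S ∖ N(S) are pairwise non-adjacent.  Each of them has at least two
-- neighbours in L(G), all lying in N(I), while an edge is adjacent to at most two members
-- of I (one through each of its endpoints); double counting gives |I| ≤ |N(I)|.  Since
-- N(I) ⊆ N(S) ∖ S, we get |S| = |S ∩ N(S)| + |I| ≤ |N(S) ∩ S| + |N(S) ∖ S| = |N(S)|.
module Submission where

open import Defs
open import Data.Product using (Σ; _×_)
open import Function.Bundles using (Bijection)
open import Relation.Binary.PropositionalEquality using (setoid)

open import Data.Bool.Base using (_∧_)
open import Data.Bool.Properties using (∧-zeroʳ)
open import Data.Empty using (⊥-elim)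
open import Data.Fin.Base using (Fin; zero; suc; punchOut)
open import Data.Fin.Properties using (any?; _≟_; injective⇒≤; punchOut-injective)
open import Data.Fin.Subset
open import Data.Fin.Subset.Induction using (⊂-wellFounded)
open import Data.Fin.Subset.Properties
open import Data.Nat.Base using (ℕ; zero; suc; _+_; _*_; _≤_; _<_; z≤n; s≤s)
open import Data.Nat.Properties as ℕ using ()
open import Algebra.Properties.Semiring.Sum ℕ.+-*-semiring
  using (sum; sum-syntax; ∑-comm; sum-cong-≗; sum-replicate-zero; *-distribʳ-sum)
open import Data.Product using (∃; _,_; proj₁; proj₂; uncurry)
open import Data.Sum using (_⊎_; inj₁; inj₂)
open import Data.Vec.Base using ([]; _∷_; here; there; lookup; tabulate)
open import Data.Vec.Functional using (Vector)
open import Data.Vec.Properties using (lookup∘tabulate; lookup⇒[]=; []=⇒lookup; lookup-zipWith)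
open import Function.Base using (_∘_; flip)
open import Function.Bundles using (_⤖_; mk⤖)
open import Function.Consequences.Propositional using (strictlySurjective⇒surjective)
open import Function.Definitions using (Injective; StrictlySurjective)
open import Induction.WellFounded using (WfRec; module All)
open import Level using (Level)
open import Relation.Binary.Core using (REL)
open import Relation.Binary.Definitions using (Decidable)
open import Relation.Binary.PropositionalEquality
  using (_≡_; _≢_; refl; sym; trans; cong; subst; ≢-sym)
open import Relation.Nullary using (Dec; yes; no; does; ¬_; ¬?; contradiction; _×-dec_; _⊎-dec_)
import Relation.Nullary.Decidable as Dec
open import Relation.Unary using (Pred)
import Relation.Unary as U

private
  variable
    ℓ : Level
    n : ℕ

subsetOf : {P : Pred (Fin n) ℓ} → U.Decidable P → Subset n
subsetOf P? = tabulate (does ∘ P?)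

module _ {P : Pred (Fin n) ℓ} (P? : U.Decidable P) where

  ∈subsetOf⁺ : ∀ {x} → P x → x ∈ subsetOf P?
  ∈subsetOf⁺ {x} px = lookup⇒[]= x _ (trans (lookup∘tabulate _ x) (Dec.dec-true (P? x) px))

  ∈subsetOf⁻ : ∀ {x} → x ∈ subsetOf P? → P x
  ∈subsetOf⁻ {x} x∈ with P? x | trans (sym (lookup∘tabulate (does ∘ P?) x)) ([]=⇒lookup x∈)
  ... | yes px | _  = px
  ... | no  _  | ()

Empty⇒∣p∣≡0 : ∀ {p : Subset n} → Empty p → ∣ p ∣ ≡ 0
Empty⇒∣p∣≡0 {n} empty = trans (cong ∣_∣ (Empty-unique empty)) (∣⊥∣≡0 n)

x∈p⇒0<∣p∣ : ∀ {x} {p : Subset n} → x ∈ p → 0 < ∣ p ∣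
x∈p⇒0<∣p∣ {x = x} {p} x∈p = subst (_≤ ∣ p ∣) (∣⁅x⁆∣≡1 x) (p⊆q⇒∣p∣≤∣q∣ ⁅x⁆⊆p)
  where
  ⁅x⁆⊆p : ⁅ x ⁆ ⊆ p
  ⁅x⁆⊆p y∈⁅x⁆ = subst (_∈ p) (sym (x∈⁅y⁆⇒x≡y x y∈⁅x⁆)) x∈p

0<∣p∣⇒Nonempty : ∀ {p : Subset n} → 0 < ∣ p ∣ → Nonempty p
0<∣p∣⇒Nonempty {p = p} 0<∣p∣ with nonempty? p
... | yes nonempty = nonempty
... | no  empty    = contradiction (Empty⇒∣p∣≡0 empty) (ℕ.>⇒≢ 0<∣p∣)

x∈p∧y∈p∧x≢y⇒1<∣p∣ : ∀ {x y} {p : Subset n} → x ∈ p → y ∈ p → x ≢ y → 1 < ∣ p ∣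
x∈p∧y∈p∧x≢y⇒1<∣p∣ x∈p y∈p x≢y =
  ℕ.≤-trans (s≤s (x∈p⇒0<∣p∣ (x∈p∧x≢y⇒x∈p-y y∈p (≢-sym x≢y)))) (x∈p⇒∣p-x∣<∣p∣ x∈p)

subsingleton⇒∣p∣≤1 : ∀ {p : Subset n} → (∀ {x y} → x ∈ p → y ∈ p → x ≡ y) → ∣ p ∣ ≤ 1
subsingleton⇒∣p∣≤1 {p = p} unique with nonempty? p
... | yes (x , x∈p) = subst (∣ p ∣ ≤_) (∣⁅x⁆∣≡1 x) (p⊆q⇒∣p∣≤∣q∣ p⊆⁅x⁆)
  where
  p⊆⁅x⁆ : p ⊆ ⁅ x ⁆
  p⊆⁅x⁆ y∈p = subst (_∈ ⁅ x ⁆) (unique x∈p y∈p) (x∈⁅x⁆ x)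
... | no  empty     = subst (_≤ 1) (sym (Empty⇒∣p∣≡0 empty)) z≤n

x∈p─q⇒x∉q : ∀ {p q : Subset n} {x} → x ∈ p ─ q → x ∉ q
x∈p─q⇒x∉q {p = _ ∷ _} {outside ∷ _} here          ()
x∈p─q⇒x∉q {p = _ ∷ _} {_ ∷ _}       (there x∈p─q) (there x∈q) = x∈p─q⇒x∉q x∈p─q x∈q

∣p∣≡∣p∩q∣+∣p─q∣ : ∀ (p q : Subset n) → ∣ p ∣ ≡ ∣ p ∩ q ∣ + ∣ p ─ q ∣
∣p∣≡∣p∩q∣+∣p─q∣ []            []            = refl
∣p∣≡∣p∩q∣+∣p─q∣ (outside ∷ p) (inside ∷ q)  = ∣p∣≡∣p∩q∣+∣p─q∣ p q
∣p∣≡∣p∩q∣+∣p─q∣ (outside ∷ p) (outside ∷ q) = ∣p∣≡∣p∩q∣+∣p─q∣ p q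
∣p∣≡∣p∩q∣+∣p─q∣ (inside ∷ p)  (inside ∷ q)  = cong suc (∣p∣≡∣p∩q∣+∣p─q∣ p q)
∣p∣≡∣p∩q∣+∣p─q∣ (inside ∷ p)  (outside ∷ q) =
  trans (cong suc (∣p∣≡∣p∩q∣+∣p─q∣ p q)) (sym (ℕ.+-suc _ _))

∣p∪q∣≤∣p∣+∣q∣ : ∀ (p q : Subset n) → ∣ p ∪ q ∣ ≤ ∣ p ∣ + ∣ q ∣
∣p∪q∣≤∣p∣+∣q∣ []            []            = z≤n
∣p∪q∣≤∣p∣+∣q∣ (inside ∷ p)  (x ∷ q)       =
  s≤s (ℕ.≤-trans (∣p∪q∣≤∣p∣+∣q∣ p q) (ℕ.+-monoʳ-≤ ∣ p ∣ (∣p∣≤∣x∷p∣ x q)))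
∣p∪q∣≤∣p∣+∣q∣ (outside ∷ p) (inside ∷ q)  =
  ℕ.≤-trans (s≤s (∣p∪q∣≤∣p∣+∣q∣ p q)) (ℕ.≤-reflexive (sym (ℕ.+-suc _ _)))
∣p∪q∣≤∣p∣+∣q∣ (outside ∷ p) (outside ∷ q) = ∣p∪q∣≤∣p∣+∣q∣ p q

∣p∣+∣q∣≤∣p∪q∣ : ∀ (p q : Subset n) → (∀ {x} → x ∈ q → x ∉ p) → ∣ p ∣ + ∣ q ∣ ≤ ∣ p ∪ q ∣
∣p∣+∣q∣≤∣p∪q∣ p q disjoint = begin
  ∣ p ∣ + ∣ q ∣                      ≤⟨ ℕ.+-mono-≤ (p⊆q⇒∣p∣≤∣q∣ p⊆[p∪q]∩p) (p⊆q⇒∣p∣≤∣q∣ q⊆[p∪q]─p) ⟩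
  ∣ (p ∪ q) ∩ p ∣ + ∣ (p ∪ q) ─ p ∣  ≡⟨ ∣p∣≡∣p∩q∣+∣p─q∣ (p ∪ q) p ⟨
  ∣ p ∪ q ∣                          ∎
  where
  open ℕ.≤-Reasoning
  p⊆[p∪q]∩p : p ⊆ (p ∪ q) ∩ p
  p⊆[p∪q]∩p x∈p = x∈p∩q⁺ (p⊆p∪q q x∈p , x∈p)
  q⊆[p∪q]─p : q ⊆ (p ∪ q) ─ p
  q⊆[p∪q]─p x∈q = x∈p∧x∉q⇒x∈p─q (q⊆p∪q p q x∈q) (disjoint x∈q)

-- Double counting

𝟙 : Side → ℕ
𝟙 inside  = 1
𝟙 outside = 0

∣p∣≡∑𝟙 : ∀ (p : Subset n) → ∣ p ∣ ≡ ∑[ i < n ] 𝟙 (lookup p i)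
∣p∣≡∑𝟙 []            = refl
∣p∣≡∑𝟙 (inside ∷ p)  = cong suc (∣p∣≡∑𝟙 p)
∣p∣≡∑𝟙 (outside ∷ p) = ∣p∣≡∑𝟙 p

∣p∩subsetOf∣≡∑𝟙 : ∀ (p : Subset n) {P : Pred (Fin n) ℓ} (P? : U.Decidable P) →
                  ∣ p ∩ subsetOf P? ∣ ≡ ∑[ i < n ] 𝟙 (lookup p i ∧ does (P? i))
∣p∩subsetOf∣≡∑𝟙 p P? = trans (∣p∣≡∑𝟙 (p ∩ subsetOf P?)) (sum-cong-≗ λ i → cong 𝟙
  (trans (lookup-zipWith _∧_ i p (subsetOf P?)) (cong (lookup p i ∧_) (lookup∘tabulate (does ∘ P?) i))))

∑-mono-≤ : ∀ {f g : Vector ℕ n} → (∀ i → f i ≤ g i) → sum f ≤ sum g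
∑-mono-≤ {zero}  _   = z≤n
∑-mono-≤ {suc n} f≤g = ℕ.+-mono-≤ (f≤g zero) (∑-mono-≤ (f≤g ∘ suc))

module _ {a b : ℕ} {R : REL (Fin a) (Fin b) ℓ} (R? : Decidable R) (P : Subset a) (Q : Subset b) (k : ℕ) where

  private
    incidence : Fin a → Fin b → ℕ
    incidence x y = 𝟙 (lookup P x ∧ lookup Q y ∧ does (R? x y))

  double-counting : (∀ {x} → x ∈ P → k ≤ ∣ Q ∩ subsetOf (R? x) ∣) →
                    (∀ {y} → y ∈ Q → ∣ P ∩ subsetOf (flip R? y) ∣ ≤ k) →
                    ∣ P ∣ * k ≤ ∣ Q ∣ * k
  double-counting k≤degree codegree≤k = begin
    ∣ P ∣ * k                            ≡⟨ cong (_* k) (∣p∣≡∑𝟙 P) ⟩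
    sum (𝟙 ∘ lookup P) * k               ≡⟨ *-distribʳ-sum k (𝟙 ∘ lookup P) ⟩
    ∑[ x < a ] (𝟙 (lookup P x) * k)      ≤⟨ ∑-mono-≤ row ⟩
    ∑[ x < a ] ∑[ y < b ] incidence x y  ≡⟨ ∑-comm incidence ⟩
    ∑[ y < b ] ∑[ x < a ] incidence x y  ≤⟨ ∑-mono-≤ column ⟩
    ∑[ y < b ] (𝟙 (lookup Q y) * k)      ≡⟨ *-distribʳ-sum k (𝟙 ∘ lookup Q) ⟨
    sum (𝟙 ∘ lookup Q) * k               ≡⟨ cong (_* k) (∣p∣≡∑𝟙 Q) ⟨
    ∣ Q ∣ * k                            ∎
    where
    open ℕ.≤-Reasoning
    row : ∀ x → 𝟙 (lookup P x) * k ≤ ∑[ y < b ] incidence x y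
    row x with lookup P x in x∈P
    ... | outside = z≤n
    ... | inside  = begin
      1 * k                                      ≡⟨ ℕ.*-identityˡ k ⟩
      k                                          ≤⟨ k≤degree (lookup⇒[]= x P x∈P) ⟩
      ∣ Q ∩ subsetOf (R? x) ∣                    ≡⟨ ∣p∩subsetOf∣≡∑𝟙 Q (R? x) ⟩
      ∑[ y < b ] 𝟙 (lookup Q y ∧ does (R? x y))  ∎
    column : ∀ y → ∑[ x < a ] incidence x y ≤ 𝟙 (lookup Q y) * k
    column y with lookup Q y in y∈Q
    ... | outside = ℕ.≤-reflexive
      (trans (sum-cong-≗ (λ x → cong 𝟙 (∧-zeroʳ (lookup P x)))) (sum-replicate-zero a))
    ... | inside  = begin
      ∑[ x < a ] 𝟙 (lookup P x ∧ does (R? x y))  ≡⟨ ∣p∩subsetOf∣≡∑𝟙 P (flip R? y) ⟨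
      ∣ P ∩ subsetOf (flip R? y) ∣               ≤⟨ codegree≤k (lookup⇒[]= y Q y∈Q) ⟩
      k                                          ≡⟨ ℕ.*-identityˡ k ⟨
      1 * k                                      ∎

injective⇒strictlySurjective : ∀ {f : Fin n → Fin n} → Injective _≡_ _≡_ f → StrictlySurjective _≡_ f
injective⇒strictlySurjective {suc n} {f} f-injective y with any? (λ x → f x ≟ y)
... | yes hit = hit
... | no miss = contradiction (injective⇒≤ punchOut∘f-injective) ℕ.1+n≰n
  where
  y≢f : ∀ x → y ≢ f x
  y≢f x y≡fx = miss (x , sym y≡fx)
  punchOut∘f-injective : Injective _≡_ _≡_ (λ x → punchOut (y≢f x))
  punchOut∘f-injective = f-injective ∘ punchOut-injective (y≢f _) (y≢f _)

-- Hall's theorem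

module _ {a b : ℕ} {ℓ : Level} where

  neighbourhood : {R : REL (Fin a) (Fin b) ℓ} → Decidable R → Subset a → Subset b
  neighbourhood R? S = subsetOf (λ y → any? (λ x → x ∈? S ×-dec R? x y))

  module _ {R : REL (Fin a) (Fin b) ℓ} (R? : Decidable R) {S : Subset a} where

    ∈neighbourhood⁺ : ∀ {x y} → x ∈ S → R x y → y ∈ neighbourhood R? S
    ∈neighbourhood⁺ x∈S xRy = ∈subsetOf⁺ (λ y → any? (λ x → x ∈? S ×-dec R? x y)) (_ , x∈S , xRy)

    ∈neighbourhood⁻ : ∀ {y} → y ∈ neighbourhood R? S → ∃ λ x → x ∈ S × R x y
    ∈neighbourhood⁻ = ∈subsetOf⁻ (λ y → any? (λ x → x ∈? S ×-dec R? x y))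

  HallCondition : {R : REL (Fin a) (Fin b) ℓ} → Decidable R → Subset a → Set
  HallCondition R? L = ∀ {S} → S ⊆ L → ∣ S ∣ ≤ ∣ neighbourhood R? S ∣

  record Matching (R : REL (Fin a) (Fin b) ℓ) (L : Subset a) : Set ℓ where
    field
      partner   : ∀ {x} → x ∈ L → Fin b
      related   : ∀ {x} (x∈L : x ∈ L) → R x (partner x∈L)
      injective : ∀ {x y} (x∈L : x ∈ L) (y∈L : y ∈ L) → partner x∈L ≡ partner y∈L → x ≡ y

  -- Deleting the vertices Y from the right-hand side, expressed as a restriction of the relation.
  _avoiding_ : REL (Fin a) (Fin b) ℓ → Subset b → REL (Fin a) (Fin b) ℓ
  (R avoiding Y) x y = R x y × y ∉ Y

  avoiding? : {R : REL (Fin a) (Fin b) ℓ} → Decidable R → ∀ Y → Decidable (R avoiding Y)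
  avoiding? R? Y x y = R? x y ×-dec ¬? (y ∈? Y)

  module _ {R : REL (Fin a) (Fin b) ℓ} (R? : Decidable R) (Y : Subset b) where

    neighbourhood⊆Y∪avoiding : ∀ {S} → neighbourhood R? S ⊆ Y ∪ neighbourhood (avoiding? R? Y) S
    neighbourhood⊆Y∪avoiding {x = y} y∈N with y ∈? Y | ∈neighbourhood⁻ R? y∈N
    ... | yes y∈Y | _             = x∈p∪q⁺ (inj₁ y∈Y)
    ... | no  y∉Y | _ , x∈S , xRy = x∈p∪q⁺ (inj₂ (∈neighbourhood⁺ (avoiding? R? Y) x∈S (xRy , y∉Y)))

    neighbourhood-∪⊆Y∪avoiding : ∀ {S T} → neighbourhood R? S ⊆ Y →
                                 neighbourhood R? (S ∪ T) ⊆ Y ∪ neighbourhood (avoiding? R? Y) T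
    neighbourhood-∪⊆Y∪avoiding {S} {T} N[S]⊆Y {y} y∈N with y ∈? Y | ∈neighbourhood⁻ R? y∈N
    ... | yes y∈Y | _               = x∈p∪q⁺ (inj₁ y∈Y)
    ... | no  y∉Y | _ , x∈S∪T , xRy with x∈p∪q⁻ S T x∈S∪T
    ...   | inj₁ x∈S = contradiction (N[S]⊆Y (∈neighbourhood⁺ R? x∈S xRy)) y∉Y
    ...   | inj₂ x∈T = x∈p∪q⁺ (inj₂ (∈neighbourhood⁺ (avoiding? R? Y) x∈T (xRy , y∉Y)))

  emptyMatching : ∀ {R : REL (Fin a) (Fin b) ℓ} {L} → Empty L → Matching R L
  emptyMatching empty = record
    { partner   = λ x∈L → ⊥-elim (empty (_ , x∈L))
    ; related   = λ x∈L → ⊥-elim (empty (_ , x∈L))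
    ; injective = λ x∈L _ _ → ⊥-elim (empty (_ , x∈L))
    }

  singletonMatching : ∀ {R : REL (Fin a) (Fin b) ℓ} {x y} → R x y → Matching R ⁅ x ⁆
  singletonMatching {R = R} {x} {y} xRy = record
    { partner   = λ _ → y
    ; related   = λ x′∈⁅x⁆ → subst (λ x′ → R x′ y) (sym (x∈⁅y⁆⇒x≡y x x′∈⁅x⁆)) xRy
    ; injective = λ x′∈⁅x⁆ x″∈⁅x⁆ _ → trans (x∈⁅y⁆⇒x≡y x x′∈⁅x⁆) (sym (x∈⁅y⁆⇒x≡y x x″∈⁅x⁆))
    }

  module _ {R : REL (Fin a) (Fin b) ℓ} {L S : Subset a} {Y : Subset b}
           (inner : Matching R S) (outer : Matching (R avoiding Y) (L ─ S)) where

    private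
      module I = Matching inner
      module O = Matching outer

    glue : (∀ {x} (x∈S : x ∈ S) → I.partner x∈S ∈ Y) → Matching R L
    glue inner⊆Y = record { partner = partner ; related = related ; injective = injective }
      where
      partner : ∀ {x} → x ∈ L → Fin b
      partner {x} x∈L with x ∈? S
      ... | yes x∈S = I.partner x∈S
      ... | no  x∉S = O.partner (x∈p∧x∉q⇒x∈p─q x∈L x∉S)

      related : ∀ {x} (x∈L : x ∈ L) → R x (partner x∈L)
      related {x} x∈L with x ∈? S
      ... | yes x∈S = I.related x∈S
      ... | no  x∉S = proj₁ (O.related (x∈p∧x∉q⇒x∈p─q x∈L x∉S))

      separated : ∀ {x y} (x∈S : x ∈ S) (y∈L─S : y ∈ L ─ S) → I.partner x∈S ≢ O.partner y∈L─S
      separated x∈S y∈L─S eq = proj₂ (O.related y∈L─S) (subst (_∈ Y) eq (inner⊆Y x∈S))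

      injective : ∀ {x y} (x∈L : x ∈ L) (y∈L : y ∈ L) → partner x∈L ≡ partner y∈L → x ≡ y
      injective {x} {y} x∈L y∈L eq with x ∈? S | y ∈? S
      ... | yes x∈S | yes y∈S = I.injective x∈S y∈S eq
      ... | yes x∈S | no  _   = contradiction eq (separated x∈S _)
      ... | no  _   | yes y∈S = contradiction (sym eq) (separated y∈S _)
      ... | no  _   | no  _   = O.injective _ _ eq

  Tight : {R : REL (Fin a) (Fin b) ℓ} → Decidable R → Subset a → Subset a → Set
  Tight R? L S = Nonempty S × S ⊂ L × ∣ neighbourhood R? S ∣ ≤ ∣ S ∣

  tight? : {R : REL (Fin a) (Fin b) ℓ} (R? : Decidable R) (L : Subset a) → U.Decidable (Tight R? L)
  tight? R? L S = nonempty? S ×-dec S ⊂? L ×-dec ∣ neighbourhood R? S ∣ ℕ.≤? ∣ S ∣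

  HallProblem : Subset a → Set (Level.suc ℓ)
  HallProblem L = ∀ {R : REL (Fin a) (Fin b) ℓ} (R? : Decidable R) → HallCondition R? L → Matching R L

  module _ {L : Subset a} (rec : WfRec _⊂_ HallProblem L)
           {R : REL (Fin a) (Fin b) ℓ} (R? : Decidable R) (hallL : HallCondition R? L) where

    private
      N = neighbourhood R?

    matchTight : ∀ {S} → Tight R? L S → Matching R L
    matchTight {S} ((x , x∈S) , S⊂L@(S⊆L , _) , ∣N[S]∣≤∣S∣) =
      glue inner outer (λ x∈S → ∈neighbourhood⁺ R? x∈S (Matching.related inner x∈S))
      where
      R′? = avoiding? R? (N S)
      inner : Matching R S
      inner = rec S⊂L R? (λ T⊆S → hallL (⊆-trans T⊆S S⊆L))
      hallOuter : HallCondition R′? (L ─ S)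
      hallOuter {T} T⊆L─S = ℕ.+-cancelˡ-≤ ∣ S ∣ ∣ T ∣ _ (begin
        ∣ S ∣ + ∣ T ∣                      ≤⟨ ∣p∣+∣q∣≤∣p∪q∣ S T (λ x∈T → x∈p─q⇒x∉q (T⊆L─S x∈T)) ⟩
        ∣ S ∪ T ∣                          ≤⟨ hallL S∪T⊆L ⟩
        ∣ N (S ∪ T) ∣                      ≤⟨ p⊆q⇒∣p∣≤∣q∣ (neighbourhood-∪⊆Y∪avoiding R? (N S) (λ y∈N → y∈N)) ⟩
        ∣ N S ∪ neighbourhood R′? T ∣      ≤⟨ ∣p∪q∣≤∣p∣+∣q∣ (N S) _ ⟩
        ∣ N S ∣ + ∣ neighbourhood R′? T ∣  ≤⟨ ℕ.+-monoˡ-≤ _ ∣N[S]∣≤∣S∣ ⟩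
        ∣ S ∣ + ∣ neighbourhood R′? T ∣    ∎)
        where
        open ℕ.≤-Reasoning
        S∪T⊆L : S ∪ T ⊆ L
        S∪T⊆L x∈S∪T with x∈p∪q⁻ S T x∈S∪T
        ... | inj₁ x∈S = S⊆L x∈S
        ... | inj₂ x∈T = p─q⊆p L S (T⊆L─S x∈T)
      outer : Matching (R avoiding N S) (L ─ S)
      outer = rec (p∩q≢∅⇒p─q⊂p L S (x , x∈p∩q⁺ (S⊆L x∈S , x∈S))) R′? hallOuter

    matchLoose : ∀ {x₀} → x₀ ∈ L → ¬ ∃ (Tight R? L) → Matching R L
    matchLoose {x₀} x₀∈L no-tight = glue (singletonMatching x₀Ry₀) outer (λ _ → x∈⁅x⁆ y₀)
      where
      ⁅x₀⁆⊆L : ⁅ x₀ ⁆ ⊆ L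
      ⁅x₀⁆⊆L x∈⁅x₀⁆ = subst (_∈ L) (sym (x∈⁅y⁆⇒x≡y x₀ x∈⁅x₀⁆)) x₀∈L
      y₀∈N[x₀] : Nonempty (N ⁅ x₀ ⁆)
      y₀∈N[x₀] = 0<∣p∣⇒Nonempty (subst (_≤ ∣ N ⁅ x₀ ⁆ ∣) (∣⁅x⁆∣≡1 x₀) (hallL ⁅x₀⁆⊆L))
      y₀ = proj₁ y₀∈N[x₀]
      x₀Ry₀ : R x₀ y₀
      x₀Ry₀ with ∈neighbourhood⁻ R? (proj₂ y₀∈N[x₀])
      ... | x , x∈⁅x₀⁆ , xRy₀ = subst (λ x → R x y₀) (x∈⁅y⁆⇒x≡y x₀ x∈⁅x₀⁆) xRy₀
      R′? = avoiding? R? ⁅ y₀ ⁆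
      -- Every nonempty T ⊆ L - x₀ is a proper subset of L, hence has a surplus neighbour
      -- that pays for the loss of y₀.
      hallOuter : HallCondition R′? (L - x₀)
      hallOuter {T} T⊆L-x₀ with nonempty? T
      ... | no  T-empty    = subst (_≤ ∣ neighbourhood R′? T ∣) (sym (Empty⇒∣p∣≡0 T-empty)) z≤n
      ... | yes T-nonempty = ℕ.≤-pred (begin-strict
        ∣ T ∣                                 <⟨ ℕ.≰⇒> (λ N≤T → no-tight (T , T-nonempty , T⊂L , N≤T)) ⟩
        ∣ N T ∣                               ≤⟨ p⊆q⇒∣p∣≤∣q∣ (neighbourhood⊆Y∪avoiding R? ⁅ y₀ ⁆) ⟩
        ∣ ⁅ y₀ ⁆ ∪ neighbourhood R′? T ∣      ≤⟨ ∣p∪q∣≤∣p∣+∣q∣ ⁅ y₀ ⁆ _ ⟩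
        ∣ ⁅ y₀ ⁆ ∣ + ∣ neighbourhood R′? T ∣  ≡⟨ cong (_+ ∣ neighbourhood R′? T ∣) (∣⁅x⁆∣≡1 y₀) ⟩
        suc ∣ neighbourhood R′? T ∣           ∎)
        where
        open ℕ.≤-Reasoning
        T⊂L : T ⊂ L
        T⊂L = (λ x∈T → p─q⊆p L ⁅ x₀ ⁆ (T⊆L-x₀ x∈T)) , x₀ , x₀∈L ,
              (λ x₀∈T → x∈p─q⇒x∉q (T⊆L-x₀ x₀∈T) (x∈⁅x⁆ x₀))
      outer : Matching (R avoiding ⁅ y₀ ⁆) (L - x₀)
      outer = rec (x∈p⇒p-x⊂p x₀∈L) R′? hallOuter

  -- Halmos–Vaughan induction on L: split L along a tight set if there is one, otherwise
  -- match an arbitrary x₀ ∈ L and recurse on L - x₀.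
  hall : ∀ L → HallProblem L
  hall = All.wfRec ⊂-wellFounded _ HallProblem step
    where
    step : ∀ L → WfRec _⊂_ HallProblem L → HallProblem L
    step L rec R? hallL with nonempty? L | anySubset? (tight? R? L)
    ... | no  L-empty     | _                 = emptyMatching L-empty
    ... | yes _           | yes (_ , S-tight) = matchTight rec R? hallL S-tight
    ... | yes (_ , x₀∈L)  | no  no-tight      = matchLoose rec R? hallL x₀∈L no-tight

-- Line graphs

module LineGraph (G : SimpleGraph) where

  open SimpleGraph G

  private
    variable
      e e′ : Edge
      x y : Vertex

  _∈ₑ?_ : ∀ x e → Dec (x ∈ₑ e)
  x ∈ₑ? e = x ≟ end₁ e ⊎-dec x ≟ end₂ e

  ShareVertex : Edge → Edge → Set
  ShareVertex e e′ = ∃ λ x → x ∈ₑ e × x ∈ₑ e′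

  endpoints : x ≢ y → x ∈ₑ e → y ∈ₑ e →
              (x ≡ end₁ e × y ≡ end₂ e) ⊎ (x ≡ end₂ e × y ≡ end₁ e)
  endpoints x≢y (inj₁ x≡₁) (inj₁ y≡₁) = contradiction (trans x≡₁ (sym y≡₁)) x≢y
  endpoints x≢y (inj₁ x≡₁) (inj₂ y≡₂) = inj₁ (x≡₁ , y≡₂)
  endpoints x≢y (inj₂ x≡₂) (inj₁ y≡₁) = inj₂ (x≡₂ , y≡₁)
  endpoints x≢y (inj₂ x≡₂) (inj₂ y≡₂) = contradiction (trans x≡₂ (sym y≡₂)) x≢y

  sameEndpoints : x ≢ y → x ∈ₑ e → y ∈ₑ e → x ∈ₑ e′ → y ∈ₑ e′ → e ≡ e′
  sameEndpoints {x} {y} {e} {e′} x≢y x∈e y∈e x∈e′ y∈e′ =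
    noMulti e e′ (match (endpoints x≢y x∈e y∈e) (endpoints x≢y x∈e′ y∈e′))
    where
    match : (x ≡ end₁ e × y ≡ end₂ e) ⊎ (x ≡ end₂ e × y ≡ end₁ e) →
            (x ≡ end₁ e′ × y ≡ end₂ e′) ⊎ (x ≡ end₂ e′ × y ≡ end₁ e′) →
            (end₁ e ≡ end₁ e′ × end₂ e ≡ end₂ e′) ⊎ (end₁ e ≡ end₂ e′ × end₂ e ≡ end₁ e′)
    match (inj₁ (x≡ , y≡)) (inj₁ (x≡′ , y≡′)) = inj₁ (trans (sym x≡) x≡′ , trans (sym y≡) y≡′)
    match (inj₁ (x≡ , y≡)) (inj₂ (x≡′ , y≡′)) = inj₂ (trans (sym x≡) x≡′ , trans (sym y≡) y≡′)
    match (inj₂ (x≡ , y≡)) (inj₁ (x≡′ , y≡′)) = inj₂ (trans (sym y≡) y≡′ , trans (sym x≡) x≡′)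
    match (inj₂ (x≡ , y≡)) (inj₂ (x≡′ , y≡′)) = inj₁ (trans (sym y≡) y≡′ , trans (sym x≡) x≡′)

  ShareExactlyOne⇒≢ : ShareExactlyOne e e′ → e ≢ e′
  ShareExactlyOne⇒≢ {e} (_ , _ , unique) refl =
    loopless e (trans (unique (end₁ e) (inj₁ refl) (inj₁ refl)) (sym (unique (end₂ e) (inj₂ refl) (inj₂ refl))))

  ≢∧ShareVertex⇒ShareExactlyOne : e ≢ e′ → ShareVertex e e′ → ShareExactlyOne e e′
  ≢∧ShareVertex⇒ShareExactlyOne e≢e′ (x , x∈e , x∈e′) = x , (x∈e , x∈e′) , unique
    where
    unique : ∀ y → y ∈ₑ _ → y ∈ₑ _ → y ≡ x
    unique y y∈e y∈e′ with y ≟ x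
    ... | yes y≡x = y≡x
    ... | no  y≢x = contradiction (sameEndpoints y≢x y∈e x∈e y∈e′ x∈e′) e≢e′

  ShareExactlyOne-sym : ShareExactlyOne e e′ → ShareExactlyOne e′ e
  ShareExactlyOne-sym s@(x , (x∈e , x∈e′) , _) =
    ≢∧ShareVertex⇒ShareExactlyOne (≢-sym (ShareExactlyOne⇒≢ s)) (x , x∈e′ , x∈e)

  adj? : Decidable ShareExactlyOne
  adj? e e′ = Dec.map′ (uncurry ≢∧ShareVertex⇒ShareExactlyOne)
    (λ s@(x , x∈both , _) → ShareExactlyOne⇒≢ s , x , x∈both)
    (¬? (e ≟ e′) ×-dec any? (λ x → x ∈ₑ? e ×-dec x ∈ₑ? e′))

  Independent : Subset m → Set
  Independent I = ∀ {e e′} → e ∈ I → e′ ∈ I → ¬ ShareExactlyOne e e′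

  through : Vertex → Subset m
  through x = subsetOf (x ∈ₑ?_)

  Independent⇒∣I∩through∣≤1 : ∀ {I} → Independent I → ∀ x → ∣ I ∩ through x ∣ ≤ 1
  Independent⇒∣I∩through∣≤1 {I} independent x = subsingleton⇒∣p∣≤1 same
    where
    same : ∀ {e e′} → e ∈ I ∩ through x → e′ ∈ I ∩ through x → e ≡ e′
    same {e} {e′} e∈ e′∈ with e ≟ e′ | x∈p∩q⁻ I (through x) e∈ | x∈p∩q⁻ I (through x) e′∈
    ... | yes e≡e′ | _          | _            = e≡e′
    ... | no  e≢e′ | e∈I , x∈e  | e′∈I , x∈e′  = contradiction
      (≢∧ShareVertex⇒ShareExactlyOne e≢e′ (x , ∈subsetOf⁻ (x ∈ₑ?_) x∈e , ∈subsetOf⁻ (x ∈ₑ?_) x∈e′))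
      (independent e∈I e′∈I)

  Independent⇒codegree≤2 : ∀ {I} → Independent I → ∀ e′ → ∣ I ∩ subsetOf (flip adj? e′) ∣ ≤ 2
  Independent⇒codegree≤2 {I} independent e′ = begin
    ∣ I ∩ subsetOf (flip adj? e′) ∣                        ≤⟨ p⊆q⇒∣p∣≤∣q∣ covered ⟩
    ∣ I ∩ through (end₁ e′) ∪ I ∩ through (end₂ e′) ∣      ≤⟨ ∣p∪q∣≤∣p∣+∣q∣ (I ∩ through (end₁ e′)) _ ⟩
    ∣ I ∩ through (end₁ e′) ∣ + ∣ I ∩ through (end₂ e′) ∣  ≤⟨ ℕ.+-mono-≤ (at-most-one (end₁ e′)) (at-most-one (end₂ e′)) ⟩
    2                                                      ∎
    where
    open ℕ.≤-Reasoning
    at-most-one = Independent⇒∣I∩through∣≤1 independent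
    covered : I ∩ subsetOf (flip adj? e′) ⊆ I ∩ through (end₁ e′) ∪ I ∩ through (end₂ e′)
    covered e∈ with x∈p∩q⁻ I _ e∈
    ... | e∈I , e~e′ with ∈subsetOf⁻ (flip adj? e′) e~e′
    ...   | x , (x∈e , inj₁ refl) , _ = x∈p∪q⁺ (inj₁ (x∈p∩q⁺ (e∈I , ∈subsetOf⁺ (x ∈ₑ?_) x∈e)))
    ...   | x , (x∈e , inj₂ refl) , _ = x∈p∪q⁺ (inj₂ (x∈p∩q⁺ (e∈I , ∈subsetOf⁺ (x ∈ₑ?_) x∈e)))

  module _ (deg≥2 : ∀ e → LDegree≥2 e) where

    private
      N = neighbourhood adj?

    Independent⇒∣I∣≤∣N[I]∣ : ∀ {I} → Independent I → ∣ I ∣ ≤ ∣ N I ∣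
    Independent⇒∣I∣≤∣N[I]∣ {I} independent = ℕ.*-cancelʳ-≤ ∣ I ∣ ∣ N I ∣ 2
      (double-counting adj? I (N I) 2 degree≥2 (λ {e′} _ → Independent⇒codegree≤2 independent e′))
      where
      degree≥2 : ∀ {e} → e ∈ I → 2 ≤ ∣ N I ∩ subsetOf (adj? e) ∣
      degree≥2 {e} e∈I with deg≥2 e
      ... | e₁ , e₂ , e₁≢e₂ , e~e₁ , e~e₂ = x∈p∧y∈p∧x≢y⇒1<∣p∣ (neighbour e~e₁) (neighbour e~e₂) e₁≢e₂
        where
        neighbour : ∀ {e′} → ShareExactlyOne e e′ → e′ ∈ N I ∩ subsetOf (adj? e)
        neighbour e~e′ = x∈p∩q⁺ (∈neighbourhood⁺ adj? e∈I e~e′ , ∈subsetOf⁺ (adj? e) e~e′)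

    lineGraphHallCondition : ∀ S → ∣ S ∣ ≤ ∣ N S ∣
    lineGraphHallCondition S = begin
      ∣ S ∣                      ≡⟨ ∣p∣≡∣p∩q∣+∣p─q∣ S (N S) ⟩
      ∣ S ∩ N S ∣ + ∣ S ─ N S ∣  ≤⟨ ℕ.+-mono-≤ (ℕ.≤-reflexive (cong ∣_∣ (∩-comm S (N S))))
                                              (ℕ.≤-trans (Independent⇒∣I∣≤∣N[I]∣ independent) (p⊆q⇒∣p∣≤∣q∣ N[I]⊆N[S]─S)) ⟩
      ∣ N S ∩ S ∣ + ∣ N S ─ S ∣  ≡⟨ ∣p∣≡∣p∩q∣+∣p─q∣ (N S) S ⟨
      ∣ N S ∣                    ∎
      where
      open ℕ.≤-Reasoning
      I = S ─ N S
      independent : Independent I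
      independent e∈I e′∈I e~e′ = x∈p─q⇒x∉q e′∈I (∈neighbourhood⁺ adj? (p─q⊆p S (N S) e∈I) e~e′)
      N[I]⊆N[S]─S : N I ⊆ N S ─ S
      N[I]⊆N[S]─S e′∈N[I] with ∈neighbourhood⁻ adj? e′∈N[I]
      ... | e , e∈I , e~e′ = x∈p∧x∉q⇒x∈p─q (∈neighbourhood⁺ adj? (p─q⊆p S (N S) e∈I) e~e′)
        (λ e′∈S → x∈p─q⇒x∉q e∈I (∈neighbourhood⁺ adj? e′∈S (ShareExactlyOne-sym e~e′)))

corollary4p4 : (G : SimpleGraph) →
    let open SimpleGraph G in
    (∀ e → LDegree≥2 e) →
    Σ (Bijection (setoid Edge) (setoid Edge)) λ f →
      ∀ e → ShareExactlyOne e (Bijection.to f e)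
corollary4p4 G deg≥2 = bijection , related ∘ member
  where
  open SimpleGraph G
  open LineGraph G
  open Matching (hall ⊤ adj? (λ {S} _ → lineGraphHallCondition deg≥2 S))
  member : ∀ e → e ∈ ⊤
  member _ = ∈⊤
  f : Edge → Edge
  f = partner ∘ member
  f-injective : Injective _≡_ _≡_ f
  f-injective = injective ∈⊤ ∈⊤
  -- f is passed explicitly: inferring it by unification makes Agda unfold the matching built by hall.
  bijection : Edge ⤖ Edge
  bijection = mk⤖ {to = f} (f-injective , strictlySurjective⇒surjective (injective⇒strictlySurjective {f = f} f-injective))
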